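{- Let $G=(V,E)$ be a graph and $\mathbf k,\mathbf u\in\mathbb{Z}_+^V$. Let $\mathbf k'\in\mathbb{Z}^V$ be defined by $k'(v)=u(N[v])-k(v)$ for each $v\in V$. Then $$L_{\mathbf k,\mathbf u}(G)=u(V)-\gamma_{\mathbf k',\mathbf u}(G)\quad\text{and}\quad \gamma_{\mathbf k,\mathbf u}(G)=u(V)-L_{\mathbf k',\mathbf u}(G).$$
   Context: Graphs are finite, simple, undirected; $N[v]$ is the closed neighborhood of $v$; for $h:V\to\mathbb{Z}$ and $U\subseteq V$, $h(U)=\sum_{x\in U}h(x)$. For integer vectors $\mathbf k,\mathbf u$ indexed by $V$ (with $\mathbf u\geq 0$), a function $f:V\to\mathbb{Z}_+$ is a $(\mathbf k,\mathbf u)$-dominating function (resp. $(\mathbf k,\mathbf u)$-packing function) of $G$ if $f(v)\leq u(v)$ and $f(N[v])\geq k(v)$ (resp. $f(N[v])\leq k(v)$) for all $v\in V$. $\gamma_{\mathbf k,\mathbf u}(G)$ is the minimum of $f(V)$ over all $(\mathbf k,\mathbf u)$-dominating functions, and $L_{\mathbf k,\mathbf u}(G)$ is the maximum of $f(V)$ over all $(\mathbf k,\mathbf u)$-packing functions, with conventions $\min\emptyset=+\infty$ and $\max\emptyset=-\infty$. (GDF is the problem of computing $\gamma_{\mathbf k,\mathbf u}(G)$, GPF that of computing $L_{\mathbf k,\mathbf u}(G)$.) -}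

module Defs where

open import Data.Nat using (ℕ; zero; suc)
open import Data.Bool using (Bool; true; false; _∨_; if_then_else_)
open import Data.Fin using (Fin; _≟_)
open import Data.Integer using (ℤ; +_; _-_; _≤_; _≥_)
import Data.Nat as N
open import Data.Product using (Σ; _×_; _,_)
open import Relation.Binary.PropositionalEquality using (_≡_)
open import Relation.Nullary.Decidable using (⌊_⌋)
open import Relation.Nullary using (¬_)
open import Data.Empty using (⊥)

record Graph (n : ℕ) : Set where
  field
    adj   : Fin n → Fin n → Bool
    sym   : ∀ v w → adj v w ≡ adj w v
    irref : ∀ v → adj v v ≡ false
open Graph public

sumV : ∀ {n} → (Fin n → ℕ) → ℕ
sumV {zero}  h = 0
sumV {suc n} h = h Fin.zero N.+ sumV {n} (λ i → h (Fin.suc i))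

inN : ∀ {n} → Graph n → Fin n → Fin n → Bool
inN G v w = ⌊ v ≟ w ⌋ ∨ adj G v w

sumN : ∀ {n} → Graph n → (Fin n → ℕ) → Fin n → ℕ
sumN G h v = sumV (λ w → if inN G v w then h w else 0)

IsDominating : ∀ {n} → Graph n → (Fin n → ℤ) → (Fin n → ℕ) → (Fin n → ℕ) → Set
IsDominating G k u f = ∀ v → (f v N.≤ u v) × (+ (sumN G f v) ≥ k v)

IsPacking : ∀ {n} → Graph n → (Fin n → ℤ) → (Fin n → ℕ) → (Fin n → ℕ) → Set
IsPacking G k u f = ∀ v → (f v N.≤ u v) × (+ (sumN G f v) ≤ k v)

data ℤ̄ : Set where
  -∞  : ℤ̄
  fin : ℤ → ℤ̄
  +∞  : ℤ̄

_⊖_ : ℤ → ℤ̄ → ℤ̄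
c ⊖ -∞    = +∞
c ⊖ fin x = fin (c - x)
c ⊖ +∞    = -∞

-- γ_{k,u}(G) ≡ x  (minimum of f(V) over dominating f; min ∅ = +∞)
IsGamma : ∀ {n} → Graph n → (Fin n → ℤ) → (Fin n → ℕ) → ℤ̄ → Set
IsGamma G k u -∞      = ⊥ -- a minimum over a set of ℤ₊ values is never -∞
IsGamma G k u (fin m) =
  Σ (Fin _ → ℕ) (λ f → IsDominating G k u f × (+ (sumV f) ≡ m))
  × (∀ f → IsDominating G k u f → m ≤ + (sumV f))
IsGamma G k u +∞      = ∀ f → ¬ IsDominating G k u f

-- L_{k,u}(G) ≡ x  (maximum of f(V) over packing f; max ∅ = -∞)
IsL : ∀ {n} → Graph n → (Fin n → ℤ) → (Fin n → ℕ) → ℤ̄ → Set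
IsL G k u -∞      = ∀ f → ¬ IsPacking G k u f
IsL G k u (fin m) =
  Σ (Fin _ → ℕ) (λ f → IsPacking G k u f × (+ (sumV f) ≡ m))
  × (∀ f → IsPacking G k u f → + (sumV f) ≤ m)
IsL G k u +∞      = ⊥ -- a maximum over a bounded set is never +∞

dualK : ∀ {n} → Graph n → (Fin n → ℕ) → (Fin n → ℕ) → Fin n → ℤ
dualK G k u v = + (sumN G u v) - + (k v)

{-# OPTIONS --safe #-}
-- Complementation f ↦ u − f is an involution on the functions bounded by u.
-- Since (u − f)(N[v]) = u(N[v]) − f(N[v]), it exchanges (k,u)-packing and
-- (k',u)-dominating functions, and likewise (k,u)-dominating and
-- (k',u)-packing ones; since (u − f)(V) = u(V) − f(V), it reverses the order
-- of total weights, so maxima on one side correspond to minima on the other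
-- and emptiness of one family to emptiness of the other.
module Submission where

open import Defs
open import Data.Nat using (ℕ)
open import Data.Fin using (Fin)
open import Data.Integer using (+_)
open import Data.Product using (_×_)
open import Function.Bundles using (_⇔_)

open import Data.Bool using (true; false; if_then_else_)
open import Data.Fin using (zero; suc)
open import Data.Integer using (ℤ; _-_; _≤_) renaming (_⊖_ to _⊖ℕ_)
import Data.Integer.Properties as ℤ
open import Data.Integer.Solver using (module +-*-Solver)
open import Data.Nat using (zero; suc; _+_; _∸_) renaming (_≤_ to _≤ℕ_)
import Data.Nat.Properties as ℕ
open import Algebra.Properties.CommutativeSemigroup ℕ.+-commutativeSemigroup
  using (interchange)
open import Data.Product using (Σ-syntax; _,_; proj₁; proj₂)
open import Function.Base using (_∘_)
open import Function.Bundles using (mk⇔)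
open import Function.Construct.Identity using (⇔-id)
open import Function.Construct.Symmetry using (⇔-sym)
open import Relation.Binary.PropositionalEquality as ≡
  using (_≡_; _≗_; refl; trans; cong; cong₂; subst; subst₂)
open import Relation.Nullary using (¬_)

minus-involutive : ∀ k i → k - (k - i) ≡ i
minus-involutive = solve 2 (λ k i → k :- (k :- i) := i) refl
  where open +-*-Solver

minus-antimonoʳ-≤ : ∀ k {i j} → i ≤ j → k - j ≤ k - i
minus-antimonoʳ-≤ k i≤j = ℤ.+-monoʳ-≤ k (ℤ.neg-mono-≤ i≤j)

minus-cancelʳ-≤ : ∀ k {i j} → k - j ≤ k - i → i ≤ j
minus-cancelʳ-≤ k {i} {j} h =
  subst₂ _≤_ (minus-involutive k i) (minus-involutive k j) (minus-antimonoʳ-≤ k h)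

minus-swapˡ-≤ : ∀ k {i j} → k - i ≤ j → k - j ≤ i
minus-swapˡ-≤ k {i} {j} h = subst (k - j ≤_) (minus-involutive k i) (minus-antimonoʳ-≤ k h)

minus-swapʳ-≤ : ∀ k {i j} → i ≤ k - j → j ≤ k - i
minus-swapʳ-≤ k {i} {j} h = subst (_≤ k - i) (minus-involutive k j) (minus-antimonoʳ-≤ k h)

m+n≡o⇒[+m]≡[+o]-[+n] : ∀ {m n o} → m + n ≡ o → + m ≡ + o - + n
m+n≡o⇒[+m]≡[+o]-[+n] {m} {n} refl = ≡.sym (begin
  + (m + n) - + n  ≡⟨ ℤ.[+m]-[+n]≡m⊖n (m + n) n ⟩
  (m + n) ⊖ℕ n     ≡⟨ ℤ.⊖-≥ (ℕ.m≤n+m n m) ⟩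
  + (m + n ∸ n)    ≡⟨ cong +_ (ℕ.m+n∸n≡m m n) ⟩
  + m              ∎)
  where open ≡.≡-Reasoning

⊖-involutive : ∀ c x → c ⊖ (c ⊖ x) ≡ x
⊖-involutive c -∞      = refl
⊖-involutive c (fin i) = cong fin (minus-involutive c i)
⊖-involutive c +∞      = refl

sumV-cong : ∀ {n} {f g : Fin n → ℕ} → f ≗ g → sumV f ≡ sumV g
sumV-cong {zero}  f≗g = refl
sumV-cong {suc n} f≗g = cong₂ _+_ (f≗g zero) (sumV-cong (f≗g ∘ suc))

sumV-+ : ∀ {n} (f g : Fin n → ℕ) → sumV (λ w → f w + g w) ≡ sumV f + sumV g
sumV-+ {zero}  f g = refl
sumV-+ {suc n} f g =
  trans (cong₂ _+_ refl (sumV-+ (f ∘ suc) (g ∘ suc)))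
        (interchange (f zero) (g zero) (sumV (f ∘ suc)) (sumV (g ∘ suc)))

module _ {n : ℕ} where

  _≤ᶠ_ : (Fin n → ℕ) → (Fin n → ℕ) → Set
  f ≤ᶠ g = ∀ w → f w ≤ℕ g w

  _∸ᶠ_ : (Fin n → ℕ) → (Fin n → ℕ) → Fin n → ℕ
  (u ∸ᶠ f) w = u w ∸ f w

  ∸ᶠ-≤ᶠ : ∀ u f → (u ∸ᶠ f) ≤ᶠ u
  ∸ᶠ-≤ᶠ u f w = ℕ.m∸n≤m (u w) (f w)

  sumV-∸ᶠ : ∀ {u f} → f ≤ᶠ u → + sumV (u ∸ᶠ f) ≡ + sumV u - + sumV f
  sumV-∸ᶠ {u} {f} f≤u = m+n≡o⇒[+m]≡[+o]-[+n]
    (trans (≡.sym (sumV-+ (u ∸ᶠ f) f)) (sumV-cong (λ w → ℕ.m∸n+n≡m (f≤u w))))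

  sumN-∸ᶠ : ∀ (G : Graph n) {u f} → f ≤ᶠ u → ∀ v →
            + sumN G (u ∸ᶠ f) v ≡ + sumN G u v - + sumN G f v
  sumN-∸ᶠ G {u} {f} f≤u v = m+n≡o⇒[+m]≡[+o]-[+n]
    (trans (≡.sym (sumV-+ (near (u ∸ᶠ f)) (near f))) (sumV-cong restricted))
    where
    near : (Fin n → ℕ) → Fin n → ℕ
    near h w = if inN G v w then h w else 0

    restricted : ∀ w → near (u ∸ᶠ f) w + near f w ≡ near u w
    restricted w with inN G v w
    ... | true  = ℕ.m∸n+n≡m (f≤u w)
    ... | false = refl

  Attains UpperBound LowerBound : ((Fin n → ℕ) → Set) → ℤ → Set
  Attains    A m = Σ[ f ∈ (Fin n → ℕ) ] A f × (+ sumV f ≡ m)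
  UpperBound A m = ∀ f → A f → + sumV f ≤ m
  LowerBound A m = ∀ f → A f → m ≤ + sumV f

  record Complementary (u : Fin n → ℕ) (A B : (Fin n → ℕ) → Set) : Set where
    field
      boundedˡ    : ∀ {f} → A f → f ≤ᶠ u
      boundedʳ    : ∀ {g} → B g → g ≤ᶠ u
      complementˡ : ∀ {f} → A f → B (u ∸ᶠ f)
      complementʳ : ∀ {g} → B g → A (u ∸ᶠ g)

  Complementary-sym : ∀ {u A B} → Complementary u A B → Complementary u B A
  Complementary-sym A⊥B = record
    { boundedˡ    = boundedʳ
    ; boundedʳ    = boundedˡ
    ; complementˡ = complementʳ
    ; complementʳ = complementˡ
    }
    where open Complementary A⊥B

  module _ {u A B} (A⊥B : Complementary u A B) where
    open Complementary A⊥B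

    private
      U : ℤ
      U = + sumV u

    complement-empty : (∀ f → ¬ A f) → ∀ g → ¬ B g
    complement-empty none g Bg = none (u ∸ᶠ g) (complementʳ Bg)

    complement-attains : ∀ {m} → Attains A m → Attains B (U - m)
    complement-attains (f , Af , Σf≡m) =
      u ∸ᶠ f , complementˡ Af , trans (sumV-∸ᶠ (boundedˡ Af)) (cong (U -_) Σf≡m)

    complement-upper⇒lower : ∀ {m} → UpperBound A m → LowerBound B (U - m)
    complement-upper⇒lower {m} upper g Bg = minus-swapˡ-≤ U
      (subst (_≤ m) (sumV-∸ᶠ (boundedʳ Bg)) (upper (u ∸ᶠ g) (complementʳ Bg)))

    complement-lower⇒upper : ∀ {m} → LowerBound B (U - m) → UpperBound A m
    complement-lower⇒upper lower f Af = minus-cancelʳ-≤ U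
      (subst (_ ≤_) (sumV-∸ᶠ (boundedˡ Af)) (lower (u ∸ᶠ f) (complementˡ Af)))

  max⇔complement-min : ∀ {u A B} → Complementary u A B → ∀ m →
                       (Attains A m × UpperBound A m)
                       ⇔ (Attains B (+ sumV u - m) × LowerBound B (+ sumV u - m))
  max⇔complement-min {u} {A} A⊥B m = mk⇔
    (λ (attained , upper) →
        complement-attains A⊥B attained , complement-upper⇒lower A⊥B upper)
    (λ (attained , lower) →
        subst (Attains A) (minus-involutive (+ sumV u) m)
          (complement-attains (Complementary-sym A⊥B) attained)
      , complement-lower⇒upper A⊥B lower)

module _ {n} (G : Graph n) (u : Fin n → ℕ) where

  dualDemand : (Fin n → ℤ) → Fin n → ℤ
  dualDemand k v = + sumN G u v - k v

  packing-bounded : ∀ {k f} → IsPacking G k u f → f ≤ᶠ u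
  packing-bounded Pf v = proj₁ (Pf v)

  dominating-bounded : ∀ {k f} → IsDominating G k u f → f ≤ᶠ u
  dominating-bounded Df v = proj₁ (Df v)

  packing-dominating-complementary : ∀ k →
    Complementary u (IsPacking G k u) (IsDominating G (dualDemand k) u)
  packing-dominating-complementary k = record
    { boundedˡ    = packing-bounded
    ; boundedʳ    = dominating-bounded
    ; complementˡ = λ {f} Pf v → ∸ᶠ-≤ᶠ u f v
        , subst (dualDemand k v ≤_) (≡.sym (sumN-∸ᶠ G (packing-bounded Pf) v))
            (minus-antimonoʳ-≤ (+ sumN G u v) (proj₂ (Pf v)))
    ; complementʳ = λ {g} Dg v → ∸ᶠ-≤ᶠ u g v
        , subst (_≤ k v) (≡.sym (sumN-∸ᶠ G (dominating-bounded Dg) v))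
            (minus-swapˡ-≤ (+ sumN G u v) (proj₂ (Dg v)))
    }

  dominating-packing-complementary : ∀ k →
    Complementary u (IsDominating G k u) (IsPacking G (dualDemand k) u)
  dominating-packing-complementary k = record
    { boundedˡ    = dominating-bounded
    ; boundedʳ    = packing-bounded
    ; complementˡ = λ {f} Df v → ∸ᶠ-≤ᶠ u f v
        , subst (_≤ dualDemand k v) (≡.sym (sumN-∸ᶠ G (dominating-bounded Df) v))
            (minus-antimonoʳ-≤ (+ sumN G u v) (proj₂ (Df v)))
    ; complementʳ = λ {g} Pg v → ∸ᶠ-≤ᶠ u g v
        , subst (k v ≤_) (≡.sym (sumN-∸ᶠ G (packing-bounded Pg) v))
            (minus-swapʳ-≤ (+ sumN G u v) (proj₂ (Pg v)))
    }

  L⇔γ-complement : ∀ {k k′} → Complementary u (IsPacking G k u) (IsDominating G k′ u) →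
                   ∀ x → IsL G k u x ⇔ IsGamma G k′ u ((+ sumV u) ⊖ x)
  L⇔γ-complement P⊥D -∞      =
    mk⇔ (complement-empty P⊥D) (complement-empty (Complementary-sym P⊥D))
  L⇔γ-complement P⊥D (fin m) = max⇔complement-min P⊥D m
  L⇔γ-complement P⊥D +∞      = ⇔-id _

  γ⇔L-complement : ∀ {k k′} → Complementary u (IsDominating G k u) (IsPacking G k′ u) →
                   ∀ x → IsGamma G k u x ⇔ IsL G k′ u ((+ sumV u) ⊖ x)
  γ⇔L-complement D⊥P x = ⇔-sym
    (subst (λ y → IsL G _ u ((+ sumV u) ⊖ x) ⇔ IsGamma G _ u y) (⊖-involutive (+ sumV u) x)
      (L⇔γ-complement (Complementary-sym D⊥P) ((+ sumV u) ⊖ x)))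

theorem1 : ∀ {n} (G : Graph n) (k u : Fin n → ℕ) →
    (∀ (x : ℤ̄) → IsL G (λ v → + (k v)) u x ⇔ IsGamma G (dualK G k u) u ((+ sumV u) ⊖ x))
    × (∀ (x : ℤ̄) → IsGamma G (λ v → + (k v)) u x ⇔ IsL G (dualK G k u) u ((+ sumV u) ⊖ x))
theorem1 G k u =
    L⇔γ-complement G u (packing-dominating-complementary G u (λ v → + k v))
  , γ⇔L-complement G u (dominating-packing-complementary G u (λ v → + k v))
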